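{- Let $G$ be a bipartite minimal configuration with partite vertex sets $V_1$ and $V_2$, where $|V_1|>|V_2|$. Then the set $CV$ of core vertices of $G$ equals $V_1$, and the set of core-forbidden vertices (the periphery $\mathcal{P}$) equals $V_2$.
   Context: For the $\{0,1\}$-adjacency matrix $\mathbf{A}$ of a graph $G$, $\eta(G)=\dim\ker\mathbf{A}$; a vertex $v$ is a core vertex if some $\mathbf{x}\in\ker\mathbf{A}$ has $x_v\neq 0$, and core-forbidden otherwise; $CV$ is the set of core vertices. A minimal configuration (MC) is a singular graph on vertex set $V$ which is either $K_1$ or, if $|V|\ge3$, has core $F=G[CV]$ and periphery $\mathcal{P}=V\setminus CV$ satisfying: (i) $\eta(G)=1$; (ii) $\mathcal{P}=\emptyset$ or $\mathcal{P}$ induces a graph consisting of isolated vertices; (iii) $|\mathcal{P}|+1=\eta(F)$. -}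

module Defs where

open import Data.Nat using (ℕ; zero; suc; _<_; _≤_)
open import Data.Fin using (Fin)
import Data.Fin as F
open import Data.Bool using (Bool; true; false; if_then_else_)
open import Data.Rational using (ℚ; 0ℚ; _+_; _*_)
open import Data.Product using (Σ; ∃; _×_; _,_)
open import Data.Sum using (_⊎_)
open import Relation.Nullary using (¬_)
open import Relation.Binary.PropositionalEquality using (_≡_; _≢_)
open import Function.Bundles using (_⇔_)

sumFin : ∀ k → (Fin k → ℚ) → ℚ
sumFin zero    f = 0ℚ
sumFin (suc k) f = f F.zero + sumFin k (λ i → f (F.suc i))

countB : ∀ n → (Fin n → Bool) → ℕ
countB zero    p = 0
countB (suc n) p = (if p F.zero then 1 else 0) Data.Nat.+ countB n (λ i → p (F.suc i))
  where import Data.Nat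

record Graph (n : ℕ) : Set where
  field
    adj   : Fin n → Fin n → Bool
    sym   : ∀ i j → adj i j ≡ adj j i
    loopless : ∀ i → adj i i ≡ false
open Graph public

entry : Bool → ℚ
entry true  = Data.Rational.1ℚ
  where import Data.Rational
entry false = 0ℚ

Vect : ℕ → Set
Vect n = Fin n → ℚ

mulA : ∀ {n} → Graph n → Vect n → Fin n → ℚ
mulA {n} G x i = sumFin n (λ j → entry (adj G i j) * x j)

VSet : ℕ → Set₁
VSet n = Fin n → Set

-- Kernel of the adjacency matrix of the induced subgraph G[S], realised as
-- vectors supported on S whose image under A vanishes on S.
-- (For S = everything this is exactly ker A.)
InKerOn : ∀ {n} → Graph n → VSet n → Vect n → Set
InKerOn {n} G S x = (∀ i → ¬ S i → x i ≡ 0ℚ) × (∀ i → S i → mulA G x i ≡ 0ℚ)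

AllV : ∀ {n} → VSet n
AllV _ = Data.Unit.⊤
  where import Data.Unit

InKer : ∀ {n} → Graph n → Vect n → Set
InKer G x = InKerOn G AllV x

lincomb : ∀ {n k} → (Fin k → ℚ) → (Fin k → Vect n) → Vect n
lincomb {n} {k} c b v = sumFin k (λ j → c j * b j v)

HasDim : ∀ {n} → (Vect n → Set) → ℕ → Set
HasDim {n} W k =
  Σ (Fin k → Vect n) λ b →
      (∀ j → W (b j))
    × (∀ c → (∀ v → lincomb c b v ≡ 0ℚ) → ∀ j → c j ≡ 0ℚ)
    × (∀ x → W x → Σ (Fin k → ℚ) λ c → ∀ v → x v ≡ lincomb c b v)

NullityOn : ∀ {n} → Graph n → VSet n → ℕ → Set
NullityOn G S k = HasDim (InKerOn G S) k

Nullity : ∀ {n} → Graph n → ℕ → Set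
Nullity G k = NullityOn G AllV k

Core : ∀ {n} → Graph n → Fin n → Set
Core G v = Σ (Vect _) λ x → InKer G x × x v ≢ 0ℚ

Periphery : ∀ {n} → Graph n → Fin n → Set
Periphery G v = ¬ Core G v

HasCard : ∀ {n} → VSet n → ℕ → Set
HasCard {n} S m =
  Σ (Fin m → Fin n) λ e →
      (∀ a b → e a ≡ e b → a ≡ b)
    × (∀ v → S v ⇔ (∃ λ a → e a ≡ v))

MinimalConfiguration : ∀ {n} → Graph n → Set
MinimalConfiguration {n} G =
    (n ≡ 1)
  ⊎ ( (3 ≤ n)
    × Nullity G 1
    × (∀ u v → Periphery G u → Periphery G v → adj G u v ≡ false)
    × (Σ ℕ λ p → HasCard (Periphery G) p × NullityOn G (Core G) (suc p)))

-- G is bipartite with bipartition given by side : Fin n → Bool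
-- (V₁ = side⁻¹ true, V₂ = side⁻¹ false): every edge joins the two parts.
IsBipartition : ∀ {n} → Graph n → (Fin n → Bool) → Set
IsBipartition G side = ∀ u v → adj G u v ≡ true → side u ≢ side v

-- Since |V₂| < |V₁|, the |V₂| equations given by the rows of A indexed by V₂ have a
-- nontrivial solution z supported on V₁; as V₁ is independent, z also satisfies the
-- equations indexed by V₁, so z ∈ ker A. With η(G) = 1 every kernel vector is a
-- multiple of z, hence vanishes on V₂: V₂ is core-forbidden. A core-forbidden vertex
-- of V₁ would then have only core-forbidden neighbours, so by (ii) it would be
-- isolated; but the indicator vector of an isolated vertex lies in ker A.
module Submission where

open import Defs renaming (sym to adj-sym)
open import Data.Nat using (zero; suc; _<_)
open import Data.Nat.Properties using (≤-pred)
open import Data.Fin using (Fin)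
import Data.Fin as F
open import Data.Bool using (Bool; true; false; not; if_then_else_)
open import Data.Product using (_×_; Σ; _,_; proj₁; proj₂)
open import Data.Sum using (_⊎_; inj₁; inj₂; [_,_])
open import Data.Empty using (⊥-elim)
open import Data.Unit using (tt)
open import Data.List using (List; []; _∷_; length; map)
open import Data.List.Properties using (length-map)
open import Data.List.Relation.Unary.All as All using (All; []; _∷_)
open import Data.List.Relation.Unary.All.Properties using (map⁻)
open import Data.List.Relation.Binary.Permutation.Propositional
  using (_↭_; ↭-refl; ↭-prep; ↭-swap; ↭-trans)
open import Data.List.Relation.Binary.Permutation.Propositional.Properties
  using (All-resp-↭; ↭-length)
open import Data.Vec.Functional as V using (head; tail)
open import Relation.Nullary using (¬_; yes; no)
open import Relation.Binary.PropositionalEquality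
  using (_≡_; _≢_; refl; sym; trans; cong; cong₂; subst; module ≡-Reasoning)
open import Function using (id; _∘_)
open import Function.Bundles using (_⇔_; mk⇔)
open import Data.Rational using (ℚ; NonZero; 0ℚ; 1ℚ; _+_; _*_; -_; _-_; 1/_; ≢-nonZero)
open import Data.Rational.Properties
  using (_≟_; 1≢0; *-zeroˡ; *-zeroʳ; +-identityʳ; *-identityˡ; *-identityʳ; +-inverseˡ; *-inverseˡ; *-inverseʳ; *-assoc;
         +-*-commutativeRing)
open import Data.Maybe using (nothing)
open import Tactic.RingSolver using (solve-∀)
open import Tactic.RingSolver.Core.AlmostCommutativeRing using (AlmostCommutativeRing; fromCommutativeRing)

ℚ-ring : AlmostCommutativeRing _ _
ℚ-ring = fromCommutativeRing +-*-commutativeRing (λ _ → nothing)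

p≢0∧p*q≡0⇒q≡0 : ∀ p q → p ≢ 0ℚ → p * q ≡ 0ℚ → q ≡ 0ℚ
p≢0∧p*q≡0⇒q≡0 p q p≢0 pq≡0 = begin
  q               ≡⟨ sym (*-identityˡ q) ⟩
  1ℚ * q          ≡⟨ cong (_* q) (sym (*-inverseˡ p)) ⟩
  (1/ p * p) * q  ≡⟨ *-assoc (1/ p) p q ⟩
  1/ p * (p * q)  ≡⟨ cong (1/ p *_) pq≡0 ⟩
  1/ p * 0ℚ       ≡⟨ *-zeroʳ (1/ p) ⟩
  0ℚ              ∎
  where
  open ≡-Reasoning
  instance _ = ≢-nonZero p≢0

true≢false : true ≢ false
true≢false ()

sumFin-zero : ∀ k (f : Fin k → ℚ) → (∀ j → f j ≡ 0ℚ) → sumFin k f ≡ 0ℚ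
sumFin-zero zero    f f≡0 = refl
sumFin-zero (suc k) f f≡0 = cong₂ _+_ (f≡0 F.zero) (sumFin-zero k (tail f) (f≡0 ∘ F.suc))

dot : ∀ k → Vect k → Vect k → ℚ
dot k r c = sumFin k (λ j → r j * c j)

dot-linearˡ : ∀ k (a b c : Vect k) t → dot k (λ j → a j - t * b j) c ≡ dot k a c - t * dot k b c
dot-linearˡ zero    a b c t = sym (cong (λ u → 0ℚ - u) (*-zeroʳ t))
dot-linearˡ (suc k) a b c t = begin
  (head a - t * head b) * head c + dot k (λ j → tail a j - t * tail b j) (tail c)
    ≡⟨ cong ((head a - t * head b) * head c +_) (dot-linearˡ k (tail a) (tail b) (tail c) t) ⟩
  (head a - t * head b) * head c + (dot k (tail a) (tail c) - t * dot k (tail b) (tail c))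
    ≡⟨ distribute (head a) (head b) (head c) t _ _ ⟩
  dot (suc k) a c - t * dot (suc k) b c ∎
  where
  open ≡-Reasoning
  distribute : ∀ a₀ b₀ c₀ t A B → (a₀ - t * b₀) * c₀ + (A - t * B) ≡ (a₀ * c₀ + A) - t * (b₀ * c₀ + B)
  distribute = solve-∀ ℚ-ring

record NontrivialSolution {k} (U : Fin k → Bool) (rows : List (Vect k)) : Set where
  field
    vec       : Vect k
    supported : ∀ j → U j ≡ false → vec j ≡ 0ℚ
    witness   : Fin k
    nonzero   : vec witness ≢ 0ℚ
    solves    : All (λ r → dot k r vec ≡ 0ℚ) rows

solution-skipFirst : ∀ {k} {U : Fin (suc k) → Bool} {rows : List (Vect (suc k))} →
  NontrivialSolution (tail U) (map tail rows) → NontrivialSolution U rows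
solution-skipFirst s = record
  { vec       = 0ℚ V.∷ vec
  ; supported = λ { F.zero _ → refl ; (F.suc j) → supported j }
  ; witness   = F.suc witness
  ; nonzero   = nonzero
  ; solves    = All.map (λ {r} solved → cong₂ _+_ (*-zeroʳ (head r)) solved) (map⁻ solves)
  }
  where open NontrivialSolution s

solution-unitFirst : ∀ {k} {U : Fin (suc k) → Bool} {rows : List (Vect (suc k))} →
  head U ≡ true → All (λ r → head r ≡ 0ℚ) rows → NontrivialSolution U rows
solution-unitFirst {k} U₀ heads≡0 = record
  { vec       = 1ℚ V.∷ (λ _ → 0ℚ)
  ; supported = λ { F.zero U₀≡false → ⊥-elim (true≢false (trans (sym U₀) U₀≡false)) ; (F.suc j) _ → refl }
  ; witness   = F.zero
  ; nonzero   = 1≢0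
  ; solves    = All.map (λ {r} r₀≡0 →
                  cong₂ _+_ (cong (_* 1ℚ) r₀≡0) (sumFin-zero k _ (λ j → *-zeroʳ (tail r j)))) heads≡0
  }

solution-resp-↭ : ∀ {k} {U : Fin k → Bool} {rows rows′ : List (Vect k)} →
  rows ↭ rows′ → NontrivialSolution U rows → NontrivialSolution U rows′
solution-resp-↭ perm s = record
  { vec = vec ; supported = supported ; witness = witness ; nonzero = nonzero
  ; solves = All-resp-↭ perm solves }
  where open NontrivialSolution s

eliminateBy : ∀ {k} (p : Vect (suc k)) .{{_ : NonZero (head p)}} → Vect (suc k) → Vect k
eliminateBy p r j = tail r j - (head r * 1/ head p) * tail p j

-- x₀ is chosen to satisfy the pivot row; the other rows then reduce to the eliminated system.
solution-eliminate : ∀ {k} {U : Fin (suc k) → Bool} {rest : List (Vect (suc k))}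
  (p : Vect (suc k)) .{{_ : NonZero (head p)}} → head U ≡ true →
  NontrivialSolution (tail U) (map (eliminateBy p) rest) → NontrivialSolution U (p ∷ rest)
solution-eliminate {k} p U₀ s = record
  { vec       = x₀ V.∷ vec
  ; supported = λ { F.zero U₀≡false → ⊥-elim (true≢false (trans (sym U₀) U₀≡false)) ; (F.suc j) → supported j }
  ; witness   = F.suc witness
  ; nonzero   = nonzero
  ; solves    = pivotSolved ∷ All.map (λ {r} → rowSolved r) (map⁻ solves)
  }
  where
  open NontrivialSolution s
  open ≡-Reasoning
  reassociate : ∀ a i d → a * (- d * i) + d ≡ - d * (a * i) + d
  reassociate = solve-∀ ℚ-ring
  reorder : ∀ a i d e → a * (- d * i) + e ≡ e - (a * i) * d
  reorder = solve-∀ ℚ-ring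
  D : ℚ
  D = dot k (tail p) vec
  x₀ : ℚ
  x₀ = - D * 1/ head p
  pivotSolved : dot (suc k) p (x₀ V.∷ vec) ≡ 0ℚ
  pivotSolved = begin
    head p * (- D * 1/ head p) + D ≡⟨ reassociate (head p) (1/ head p) D ⟩
    - D * (head p * 1/ head p) + D ≡⟨ cong (λ u → - D * u + D) (*-inverseʳ (head p)) ⟩
    - D * 1ℚ + D                  ≡⟨ cong (_+ D) (*-identityʳ (- D)) ⟩
    - D + D                       ≡⟨ +-inverseˡ D ⟩
    0ℚ                            ∎
  rowSolved : ∀ r → dot k (eliminateBy p r) vec ≡ 0ℚ → dot (suc k) r (x₀ V.∷ vec) ≡ 0ℚ
  rowSolved r solved = begin
    head r * (- D * 1/ head p) + dot k (tail r) vec  ≡⟨ reorder (head r) (1/ head p) D _ ⟩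
    dot k (tail r) vec - (head r * 1/ head p) * D    ≡⟨ sym (dot-linearˡ k (tail r) (tail p) vec (head r * 1/ head p)) ⟩
    dot k (eliminateBy p r) vec                      ≡⟨ solved ⟩
    0ℚ                                               ∎

record Pivot {k} (rows : List (Vect (suc k))) : Set where
  constructor pivotOf
  field
    row    : Vect (suc k)
    others : List (Vect (suc k))
    lead≢0 : head row ≢ 0ℚ
    split  : row ∷ others ↭ rows

findPivot : ∀ {k} (rows : List (Vect (suc k))) → All (λ r → head r ≡ 0ℚ) rows ⊎ Pivot rows
findPivot [] = inj₁ []
findPivot (r ∷ rs) with head r ≟ 0ℚ | findPivot rs
... | no r₀≢0 | _          = inj₂ (pivotOf r rs r₀≢0 ↭-refl)
... | yes r₀≡0 | inj₁ heads≡0 = inj₁ (r₀≡0 ∷ heads≡0)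
... | yes _    | inj₂ (pivotOf p rest p₀≢0 split) =
  inj₂ (pivotOf p (r ∷ rest) p₀≢0 (↭-trans (↭-swap p r ↭-refl) (↭-prep r split)))

length-map-< : ∀ {A B : Set} {m} (f : A → B) (xs : List A) → length xs < m → length (map f xs) < m
length-map-< {m = m} f xs = subst (_< m) (sym (length-map f xs))

nontrivialSolution : ∀ k (U : Fin k → Bool) (rows : List (Vect k)) →
  length rows < countB k U → NontrivialSolution U rows
nontrivialSolution zero    U rows ()
nontrivialSolution (suc k) U rows fewer with U F.zero in U₀ | findPivot rows
... | false | _ =
  solution-skipFirst (nontrivialSolution k (tail U) (map tail rows) (length-map-< tail rows fewer))
... | true  | inj₁ heads≡0 = solution-unitFirst U₀ heads≡0
... | true  | inj₂ (pivotOf p rest p₀≢0 split) =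
  solution-resp-↭ split (solution-eliminate p U₀ (nontrivialSolution k (tail U) (map (eliminateBy p) rest)
    (length-map-< (eliminateBy p) rest (≤-pred (subst (_< _) (sym (↭-length split)) fewer)))))
  where instance _ = ≢-nonZero p₀≢0

selectRows : ∀ {k} n → (Fin n → Bool) → (Fin n → Vect k) → List (Vect k)
selectRows zero    p f = []
selectRows (suc n) p f = if head p then head f ∷ rest else rest
  where
  rest : List (Vect _)
  rest = selectRows n (tail p) (tail f)

length-selectRows : ∀ {k} n p (f : Fin n → Vect k) → length (selectRows n p f) ≡ countB n p
length-selectRows zero    p f = refl
length-selectRows (suc n) p f with head p
... | true  = cong suc (length-selectRows n (tail p) (tail f))
... | false = length-selectRows n (tail p) (tail f)

All-selectRows : ∀ {k} n p (f : Fin n → Vect k) {P : Vect k → Set} →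
  All P (selectRows n p f) → ∀ i → p i ≡ true → P (f i)
All-selectRows (suc n) p f all-P i pᵢ with head p in p₀
All-selectRows (suc n) p f (Pf₀ ∷ _) F.zero    _  | true  = Pf₀
All-selectRows (suc n) p f (_ ∷ all-P) (F.suc i) pᵢ | true  = All-selectRows n (tail p) (tail f) all-P i pᵢ
All-selectRows (suc n) p f all-P       F.zero    pᵢ | false = ⊥-elim (true≢false (trans (sym pᵢ) p₀))
All-selectRows (suc n) p f all-P       (F.suc i) pᵢ | false = All-selectRows n (tail p) (tail f) all-P i pᵢ

InKer-intro : ∀ {n} {G : Graph n} {x : Vect n} → (∀ i → mulA G x i ≡ 0ℚ) → InKer G x
InKer-intro Ax≡0 = (λ _ ¬⊤ → ⊥-elim (¬⊤ tt)) , λ i _ → Ax≡0 i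

bipartite-neighbour : ∀ {n} {G : Graph n} {side : Fin n → Bool} → IsBipartition G side →
  ∀ {u v} → side u ≡ true → adj G u v ≡ true → side v ≡ false
bipartite-neighbour {side = side} bip {u} {v} sideᵤ uv with side v in sideᵥ
... | false = refl
... | true  = ⊥-elim (bip u v uv (trans sideᵤ (sym sideᵥ)))

bipartite-kernelVector : ∀ {n} (G : Graph n) (side : Fin n → Bool) → IsBipartition G side →
  countB n (λ v → not (side v)) < countB n side →
  Σ (Vect n) λ z → InKer G z × (∀ v → side v ≡ false → z v ≡ 0ℚ) × Σ (Fin n) λ w → z w ≢ 0ℚ
bipartite-kernelVector {n} G side bip fewer =
  vec , InKer-intro {G = G} (λ i → kernelEquation i (side i) refl) , supported , witness , nonzero
  where
  rowOf : Fin n → Vect n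
  rowOf i j = entry (adj G i j)
  V₂-rows : List (Vect n)
  V₂-rows = selectRows n (λ v → not (side v)) rowOf
  open NontrivialSolution (nontrivialSolution n side V₂-rows
    (subst (_< countB n side) (sym (length-selectRows n _ rowOf)) fewer))
  kernelEquation : ∀ i s → side i ≡ s → mulA G vec i ≡ 0ℚ
  kernelEquation i false sideᵢ = All-selectRows n (λ v → not (side v)) rowOf solves i (cong not sideᵢ)
  kernelEquation i true  sideᵢ = sumFin-zero n _ λ j → term j (adj G i j) refl
    where
    term : ∀ j b → adj G i j ≡ b → entry (adj G i j) * vec j ≡ 0ℚ
    term j false ij rewrite ij = *-zeroˡ (vec j)
    term j true  ij rewrite ij | supported j (bipartite-neighbour {G = G} bip sideᵢ ij) = *-zeroʳ 1ℚ

unitVect : ∀ {n} → Fin n → Vect n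
unitVect u v with v F.≟ u
... | yes _ = 1ℚ
... | no  _ = 0ℚ

unitVect-self : ∀ {n} (u : Fin n) → unitVect u u ≡ 1ℚ
unitVect-self u with u F.≟ u
... | yes _   = refl
... | no  u≢u = ⊥-elim (u≢u refl)

isolated⇒Core : ∀ {n} (G : Graph n) u → (∀ v → adj G u v ≡ false) → Core G u
isolated⇒Core {n} G u isolated =
  unitVect u , InKer-intro {G = G} (λ i → sumFin-zero n _ (term i)) ,
  λ eᵤ≡0 → 1≢0 (trans (sym (unitVect-self u)) eᵤ≡0)
  where
  term : ∀ i j → entry (adj G i j) * unitVect u j ≡ 0ℚ
  term i j with j F.≟ u
  ... | yes refl rewrite adj-sym G i j | isolated i = *-zeroˡ 1ℚ
  ... | no  _    = *-zeroʳ (entry (adj G i j))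

module NullityOne {n} (G : Graph n) (η≡1 : Nullity G 1) where

  basis : Vect n
  basis = proj₁ η≡1 F.zero

  basis∈ker : InKer G basis
  basis∈ker = proj₁ (proj₂ η≡1) F.zero

  multipleOfBasis : ∀ {x} → InKer G x → Σ ℚ λ c → ∀ v → x v ≡ c * basis v
  multipleOfBasis x∈ker with proj₂ (proj₂ (proj₂ η≡1)) _ x∈ker
  ... | c , x≡cb = c F.zero , λ v → trans (x≡cb v) (+-identityʳ _)

  basis≡0⇒Periphery : ∀ {v} → basis v ≡ 0ℚ → Periphery G v
  basis≡0⇒Periphery {v} bᵥ≡0 (x , x∈ker , xᵥ≢0) with multipleOfBasis x∈ker
  ... | c , x≡cb = xᵥ≢0 (trans (x≡cb v) (trans (cong (c *_) bᵥ≡0) (*-zeroʳ c)))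

  coreOrPeriphery : ∀ v → Core G v ⊎ Periphery G v
  coreOrPeriphery v with basis v ≟ 0ℚ
  ... | yes bᵥ≡0 = inj₂ (basis≡0⇒Periphery bᵥ≡0)
  ... | no  bᵥ≢0 = inj₁ (basis , basis∈ker , bᵥ≢0)

  -- A kernel vector that is somewhere nonzero is a nonzero multiple of the basis vector.
  zeroOfKernelVector⇒Periphery : ∀ {z w v} → InKer G z → z w ≢ 0ℚ → z v ≡ 0ℚ → Periphery G v
  zeroOfKernelVector⇒Periphery {z} {w} {v} z∈ker z_w≢0 zᵥ≡0 with multipleOfBasis z∈ker
  ... | c , z≡cb = basis≡0⇒Periphery (p≢0∧p*q≡0⇒q≡0 c (basis v) c≢0 (trans (sym (z≡cb v)) zᵥ≡0))
    where
    c≢0 : c ≢ 0ℚ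
    c≢0 c≡0 = z_w≢0 (trans (z≡cb w) (trans (cong (_* basis w) c≡0) (*-zeroˡ (basis w))))

peripheralNeighbours⇒¬Periphery : ∀ {n} (G : Graph n) →
  (∀ u v → Periphery G u → Periphery G v → adj G u v ≡ false) →
  ∀ u → (∀ v → adj G u v ≡ true → Periphery G v) → ¬ Periphery G u
peripheralNeighbours⇒¬Periphery G peripheryIndependent u neighbours perᵤ =
  perᵤ (isolated⇒Core G u isolated)
  where
  isolated : ∀ v → adj G u v ≡ false
  isolated v with adj G u v in uv
  ... | false = refl
  ... | true  = trans (sym uv) (peripheryIndependent u v perᵤ (neighbours v uv))

sides⇒Core⇔Periphery : ∀ {n} (G : Graph n) (side : Fin n → Bool) →
  (∀ v → side v ≡ true → Core G v) → (∀ v → side v ≡ false → Periphery G v) →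
  (∀ v → Core G v ⇔ (side v ≡ true)) × (∀ v → Periphery G v ⇔ (side v ≡ false))
sides⇒Core⇔Periphery G side V₁⊆Core V₂⊆Periphery =
  (λ v → mk⇔ (Core⇒V₁ v) (V₁⊆Core v)) , (λ v → mk⇔ (Periphery⇒V₂ v) (V₂⊆Periphery v))
  where
  Core⇒V₁ : ∀ v → Core G v → side v ≡ true
  Core⇒V₁ v coreᵥ with side v in sideᵥ
  ... | true  = refl
  ... | false = ⊥-elim (V₂⊆Periphery v sideᵥ coreᵥ)
  Periphery⇒V₂ : ∀ v → Periphery G v → side v ≡ false
  Periphery⇒V₂ v perᵥ with side v in sideᵥ
  ... | false = refl
  ... | true  = ⊥-elim (perᵥ (V₁⊆Core v sideᵥ))

K₁-side : (side : Fin 1 → Bool) → countB 1 (λ v → not (side v)) < countB 1 side → side F.zero ≡ true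
K₁-side side fewer with side F.zero | fewer
... | true  | _ = refl
... | false | ()

mainTheorem10 : ∀ {n} (G : Graph n) (side : Fin n → Bool) →
    MinimalConfiguration G →
    IsBipartition G side →
    countB n (λ v → not (side v)) < countB n side →
    (∀ v → Core G v ⇔ (side v ≡ true)) × (∀ v → Periphery G v ⇔ (side v ≡ false))
mainTheorem10 G side (inj₁ refl) bip fewer = sides⇒Core⇔Periphery G side V₁⊆Core V₂⊆Periphery
  where
  V₁⊆Core : ∀ v → side v ≡ true → Core G v
  V₁⊆Core F.zero _ = isolated⇒Core G F.zero λ { F.zero → loopless G F.zero }
  V₂⊆Periphery : ∀ v → side v ≡ false → Periphery G v
  V₂⊆Periphery F.zero side₀ = ⊥-elim (true≢false (trans (sym (K₁-side side fewer)) side₀))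
mainTheorem10 G side (inj₂ (_ , η≡1 , peripheryIndependent , _)) bip fewer =
  sides⇒Core⇔Periphery G side V₁⊆Core V₂⊆Periphery
  where
  open NullityOne G η≡1
  V₂⊆Periphery : ∀ v → side v ≡ false → Periphery G v
  V₂⊆Periphery v sideᵥ with bipartite-kernelVector G side bip fewer
  ... | z , z∈ker , z-on-V₁ , w , z_w≢0 = zeroOfKernelVector⇒Periphery z∈ker z_w≢0 (z-on-V₁ v sideᵥ)
  V₁⊆Core : ∀ u → side u ≡ true → Core G u
  V₁⊆Core u sideᵤ = [ id , ⊥-elim ∘ ¬perᵤ ] (coreOrPeriphery u)
    where
    ¬perᵤ : ¬ Periphery G u
    ¬perᵤ = peripheralNeighbours⇒¬Periphery G peripheryIndependent u
              (λ v uv → V₂⊆Periphery v (bipartite-neighbour {G = G} bip sideᵤ uv))
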